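{- If $w$ and $w'$ are words of positive integers with $w\,\hat\equiv\,w'$, then $w|_I\,\hat\equiv\,w'|_I$ for every interval $I$ of positive integers.
   Context: Weak $K$-Knuth equivalence $\hat\equiv$ is the equivalence relation on words of positive integers generated by, for (possibly empty) words $\mathbf u,\mathbf v$ and integers $a<b<c$: $\mathbf u aa\mathbf v\,\hat\equiv\,\mathbf u a\mathbf v$; $\mathbf u aba\mathbf v\,\hat\equiv\,\mathbf u bab\mathbf v$; $\mathbf u bac\mathbf v\,\hat\equiv\,\mathbf u bca\mathbf v$; $\mathbf u acb\mathbf v\,\hat\equiv\,\mathbf u cab\mathbf v$; $ab\mathbf u\,\hat\equiv\,ba\mathbf u$. For an interval $I$, $w|_I$ is the word obtained from $w$ by deleting all letters not in $I$. -}

module Defs where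

open import Data.Nat using (ℕ; _<_; _≤_)
open import Data.Nat.Properties using (_≤?_)
open import Data.List using (List; []; _∷_; _++_; filter)
open import Data.Maybe using (Maybe; just; nothing)
open import Data.Product using (_×_)
open import Data.Unit using (⊤; tt)
open import Relation.Nullary using (Dec; yes; no)
open import Relation.Nullary.Decidable using (_×-dec_)
open import Relation.Binary.Construct.Closure.Equivalence using (EqClosure)

Word : Set
Word = List ℕ

data Step : Word → Word → Set where
  idem  : ∀ u v a → Step (u ++ a ∷ a ∷ v) (u ++ a ∷ v)
  braid : ∀ u v {a b} → a < b → Step (u ++ a ∷ b ∷ a ∷ v) (u ++ b ∷ a ∷ b ∷ v)
  knuth1 : ∀ u v {a b c} → a < b → b < c → Step (u ++ b ∷ a ∷ c ∷ v) (u ++ b ∷ c ∷ a ∷ v)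
  knuth2 : ∀ u v {a b c} → a < b → b < c → Step (u ++ a ∷ c ∷ b ∷ v) (u ++ c ∷ a ∷ b ∷ v)
  front : ∀ u {a b} → a < b → Step (a ∷ b ∷ u) (b ∷ a ∷ u)

_≡̂_ : Word → Word → Set
_≡̂_ = EqClosure Step

-- An interval of positive integers: lower bound lo ≥ 1 and an optional
-- upper bound (nothing = unbounded above).  I = {x | lo ≤ x ≤ hi}.
record Interval : Set where
  constructor interval
  field
    lo  : ℕ
    hi  : Maybe ℕ
    pos : 1 ≤ lo

UpTo : Maybe ℕ → ℕ → Set
UpTo nothing  _ = ⊤
UpTo (just h) x = x ≤ h

upTo? : (m : Maybe ℕ) → (x : ℕ) → Dec (UpTo m x)
upTo? nothing  _ = yes tt
upTo? (just h) x = x ≤? h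

_∈I_ : ℕ → Interval → Set
x ∈I I = Interval.lo I ≤ x × UpTo (Interval.hi I) x

_∈I?_ : (x : ℕ) → (I : Interval) → Dec (x ∈I I)
x ∈I? I = (Interval.lo I ≤? x) ×-dec upTo? (Interval.hi I) x

restrict : Word → Interval → Word
restrict w I = filter (λ x → x ∈I? I) w

-- Deleting the letters outside I turns each generating move into a move or into an identity
-- (a braid move with one letter outside I becomes an idempotence move).  The only
-- configuration that would leave an illegal swap in the middle of the word, a Knuth move
-- with a, c ∈ I but b ∉ I, cannot occur because I is convex.
module Submission where

open import Defs
open import Data.Nat using (_<_)
open import Data.Nat.Properties using (≤-trans; <⇒≤)
open import Data.List using ([]; _∷_; _++_; [_])
open import Data.List.Properties using (filter-++; filter-reject; filter-all)
open import Data.List.Relation.Unary.All using (All; []; _∷_)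
open import Data.Maybe using (just; nothing)
open import Data.Product using (_×_; _,_)
open import Data.Unit using (tt)
open import Relation.Nullary using (¬_; yes; no)
open import Relation.Nullary.Decidable using (_×-dec_)
open import Relation.Binary.PropositionalEquality
  using (_≡_; refl; sym; trans; cong; subst₂; module ≡-Reasoning)
open import Relation.Binary.Construct.Closure.Equivalence
  using (EqClosure; reflexive; symmetric; isEquivalence; gmap; gfold; return)

∈I-convex : ∀ I {a b c} → a < b → b < c → a ∈I I → c ∈I I → b ∈I I
∈I-convex (interval _ nothing  _) a<b _   (lo≤a , _) _        = ≤-trans lo≤a (<⇒≤ a<b) , tt
∈I-convex (interval _ (just _) _) a<b b<c (lo≤a , _) (_ , c≤h) =
  ≤-trans lo≤a (<⇒≤ a<b) , ≤-trans (<⇒≤ b<c) c≤h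

-- The moves of Step that may be applied in any context u _ v (all but the front swap).
data LocalStep : Word → Word → Set where
  idem   : ∀ a → LocalStep (a ∷ a ∷ []) [ a ]
  braid  : ∀ {a b} → a < b → LocalStep (a ∷ b ∷ a ∷ []) (b ∷ a ∷ b ∷ [])
  knuth1 : ∀ {a b c} → a < b → b < c → LocalStep (b ∷ a ∷ c ∷ []) (b ∷ c ∷ a ∷ [])
  knuth2 : ∀ {a b c} → a < b → b < c → LocalStep (a ∷ c ∷ b ∷ []) (c ∷ a ∷ b ∷ [])

LocalStep⇒Step : ∀ u v {p q} → LocalStep p q → Step (u ++ p ++ v) (u ++ q ++ v)
LocalStep⇒Step u v (idem a)         = idem u v a
LocalStep⇒Step u v (braid a<b)      = braid u v a<b
LocalStep⇒Step u v (knuth1 a<b b<c) = knuth1 u v a<b b<c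
LocalStep⇒Step u v (knuth2 a<b b<c) = knuth2 u v a<b b<c

infix 4 _≈ᴸ_
_≈ᴸ_ : Word → Word → Set
_≈ᴸ_ = EqClosure LocalStep

≡⇒≈ᴸ : ∀ {p q} → p ≡ q → p ≈ᴸ q
≡⇒≈ᴸ refl = reflexive LocalStep

module _ (I : Interval) where

  private
    infix 30 ∣_
    ∣_ : Word → Word
    ∣ w = restrict w I

  restrict-++ : ∀ u v → ∣ (u ++ v) ≡ ∣ u ++ ∣ v
  restrict-++ = filter-++ (_∈I? I)

  restrict-all : ∀ {w} → All (_∈I I) w → ∣ w ≡ w
  restrict-all = filter-all (_∈I? I)

  restrict-erase : ∀ {x} → ¬ x ∈I I → ∀ u v → ∣ (u ++ x ∷ v) ≡ ∣ (u ++ v)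
  restrict-erase {x} x∉I u v = begin
    ∣ (u ++ x ∷ v)    ≡⟨ restrict-++ u (x ∷ v) ⟩
    ∣ u ++ ∣ (x ∷ v)  ≡⟨ cong (∣ u ++_) (filter-reject (_∈I? I) x∉I) ⟩
    ∣ u ++ ∣ v        ≡⟨ restrict-++ u v ⟨
    ∣ (u ++ v)        ∎
    where open ≡-Reasoning

  restrict-swap : ∀ {x y} → ¬ (x ∈I I × y ∈I I) → ∀ u v →
                  ∣ (u ++ x ∷ y ∷ v) ≡ ∣ (u ++ y ∷ x ∷ v)
  restrict-swap {x} {y} ¬both u v = begin
    ∣ (u ++ x ∷ y ∷ v)    ≡⟨ restrict-++ u (x ∷ y ∷ v) ⟩
    ∣ u ++ ∣ (x ∷ y ∷ v)  ≡⟨ cong (∣ u ++_) swap ⟩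
    ∣ u ++ ∣ (y ∷ x ∷ v)  ≡⟨ restrict-++ u (y ∷ x ∷ v) ⟨
    ∣ (u ++ y ∷ x ∷ v)    ∎
    where
    open ≡-Reasoning
    swap : ∣ (x ∷ y ∷ v) ≡ ∣ (y ∷ x ∷ v)
    swap with x ∈I? I
    ... | no x∉I = trans (restrict-erase x∉I [] (y ∷ v)) (sym (restrict-erase x∉I [ y ] v))
    ... | yes x∈I = trans (restrict-erase y∉I [ x ] v) (sym (restrict-erase y∉I [] (x ∷ v)))
      where y∉I = λ y∈I → ¬both (x∈I , y∈I)

  restrict-LocalStep-inside : ∀ {p q} → All (_∈I I) p → All (_∈I I) q → LocalStep p q → ∣ p ≈ᴸ ∣ q
  restrict-LocalStep-inside p⊆I q⊆I p→q =
    subst₂ _≈ᴸ_ (sym (restrict-all p⊆I)) (sym (restrict-all q⊆I)) (return p→q)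

  restrict-idem : ∀ a → ∣ (a ∷ a ∷ []) ≈ᴸ ∣ [ a ]
  restrict-idem a with a ∈I? I
  ... | yes a∈I = restrict-LocalStep-inside (a∈I ∷ a∈I ∷ []) (a∈I ∷ []) (idem a)
  ... | no a∉I = ≡⇒≈ᴸ (restrict-erase a∉I [] [ a ])

  restrict-LocalStep : ∀ {p q} → LocalStep p q → ∣ p ≈ᴸ ∣ q
  restrict-LocalStep (idem a) = restrict-idem a
  restrict-LocalStep (braid {a} {b} a<b) with a ∈I? I | b ∈I? I
  ... | yes a∈I | yes b∈I =
    restrict-LocalStep-inside (a∈I ∷ b∈I ∷ a∈I ∷ []) (b∈I ∷ a∈I ∷ b∈I ∷ []) (braid a<b)
  ... | yes _ | no b∉I
    rewrite restrict-erase b∉I [ a ] [ a ] | restrict-erase b∉I [] (a ∷ b ∷ [])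
          | restrict-erase b∉I [ a ] [] = restrict-idem a
  ... | no a∉I | _
    rewrite restrict-erase a∉I [] (b ∷ a ∷ []) | restrict-erase a∉I [ b ] []
          | restrict-erase a∉I [ b ] [ b ] = symmetric LocalStep (restrict-idem b)
  restrict-LocalStep (knuth1 {a} {b} {c} a<b b<c) with a ∈I? I ×-dec c ∈I? I
  ... | yes (a∈I , c∈I) = restrict-LocalStep-inside
    (b∈I ∷ a∈I ∷ c∈I ∷ []) (b∈I ∷ c∈I ∷ a∈I ∷ []) (knuth1 a<b b<c)
    where b∈I = ∈I-convex I a<b b<c a∈I c∈I
  ... | no ¬both = ≡⇒≈ᴸ (restrict-swap ¬both [ b ] [])
  restrict-LocalStep (knuth2 {a} {b} {c} a<b b<c) with a ∈I? I ×-dec c ∈I? I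
  ... | yes (a∈I , c∈I) = restrict-LocalStep-inside
    (a∈I ∷ c∈I ∷ b∈I ∷ []) (c∈I ∷ a∈I ∷ b∈I ∷ []) (knuth2 a<b b<c)
    where b∈I = ∈I-convex I a<b b<c a∈I c∈I
  ... | no ¬both = ≡⇒≈ᴸ (restrict-swap ¬both [] [ b ])

  restrict-in-context : ∀ u v {p q} → ∣ p ≈ᴸ ∣ q → ∣ (u ++ p ++ v) ≡̂ ∣ (u ++ q ++ v)
  restrict-in-context u v {p} {q} p≈q =
    subst₂ _≡̂_ (sym (restrict-infix p)) (sym (restrict-infix q))
      (gmap (λ r → ∣ u ++ r ++ ∣ v) (LocalStep⇒Step (∣ u) (∣ v)) p≈q)
    where
    restrict-infix : ∀ r → ∣ (u ++ r ++ v) ≡ ∣ u ++ ∣ r ++ ∣ v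
    restrict-infix r = trans (restrict-++ u (r ++ v)) (cong (∣ u ++_) (restrict-++ r v))

  restrict-Step : ∀ {w w′} → Step w w′ → ∣ w ≡̂ ∣ w′
  restrict-Step (idem u v a)         = restrict-in-context u v (restrict-LocalStep (idem a))
  restrict-Step (braid u v a<b)      = restrict-in-context u v (restrict-LocalStep (braid a<b))
  restrict-Step (knuth1 u v a<b b<c) = restrict-in-context u v (restrict-LocalStep (knuth1 a<b b<c))
  restrict-Step (knuth2 u v a<b b<c) = restrict-in-context u v (restrict-LocalStep (knuth2 a<b b<c))
  restrict-Step (front u {a} {b} a<b) with a ∈I? I ×-dec b ∈I? I
  ... | yes (a∈I , b∈I)
    rewrite restrict-++ (a ∷ b ∷ []) u | restrict-++ (b ∷ a ∷ []) u
          | restrict-all (a∈I ∷ b∈I ∷ []) | restrict-all (b∈I ∷ a∈I ∷ []) = return (front (∣ u) a<b)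
  ... | no ¬both
    rewrite restrict-swap ¬both [] u = reflexive Step

lemma2p7 : (w w′ : Word) → All (0 <_) w → All (0 <_) w′ → w ≡̂ w′ →
    (I : Interval) → restrict w I ≡̂ restrict w′ I
lemma2p7 _ _ _ _ w≡̂w′ I = gfold (isEquivalence Step) (λ w → restrict w I) (restrict-Step I) w≡̂w′
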